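{- Let $G$ be a finite simple graph and let $\langle a,b:c,d\rangle$ be an alternating 4-cycle in $G$. Let $H$ be the graph obtained from $G$ by performing the 2-switch on $\langle a,b:c,d\rangle$. If $\{a,c\}$ is a module in $G-\{b,d\}$, or if $\{b,d\}$ is a module in $G-\{a,c\}$, then $G\cong H$.
   Context: An alternating 4-cycle $\langle a,b:c,d\rangle$ in a graph $G$ consists of four distinct vertices $a,b,c,d$ such that $ab$ and $cd$ are edges of $G$ while $bc$ and $ad$ are not edges of $G$. The 2-switch on $\langle a,b:c,d\rangle$ is the operation that deletes the edges $ab$ and $cd$ and adds the edges $bc$ and $ad$ (all other adjacencies unchanged). A module of a graph $J$ is a set $M\subseteq V(J)$ such that every vertex of $V(J)\setminus M$ is adjacent either to all vertices of $M$ or to none of them. $G-X$ denotes the subgraph of $G$ induced on $V(G)\setminus X$. -}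

module Defs where

open import Data.Nat using (ℕ)
open import Data.Fin using (Fin; _≟_)
open import Data.Bool using (Bool; true; false; if_then_else_; _∧_; _∨_)
open import Data.Product using (_×_; Σ; _,_)
open import Relation.Nullary using (¬_)
open import Relation.Nullary.Decidable using (⌊_⌋)
open import Relation.Binary.PropositionalEquality using (_≡_; _≢_)
open import Function.Bundles using (_↔_; Inverse)

record Graph (n : ℕ) : Set where
  field
    adj   : Fin n → Fin n → Bool
    sym   : ∀ u v → adj u v ≡ adj v u
    irrefl : ∀ v → adj v v ≡ false
open Graph public

Edge : ∀ {n} → Graph n → Fin n → Fin n → Set
Edge G u v = adj G u v ≡ true

NonEdge : ∀ {n} → Graph n → Fin n → Fin n → Set
NonEdge G u v = adj G u v ≡ false

Distinct4 : ∀ {n} → Fin n → Fin n → Fin n → Fin n → Set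
Distinct4 a b c d =
  (a ≢ b) × (a ≢ c) × (a ≢ d) × (b ≢ c) × (b ≢ d) × (c ≢ d)

AltCycle : ∀ {n} → Graph n → Fin n → Fin n → Fin n → Fin n → Set
AltCycle G a b c d =
  Distinct4 a b c d × Edge G a b × Edge G c d × NonEdge G b c × NonEdge G a d

samePair : ∀ {n} → Fin n → Fin n → Fin n → Fin n → Bool
samePair u v x y =
  (⌊ u ≟ x ⌋ ∧ ⌊ v ≟ y ⌋) ∨ (⌊ u ≟ y ⌋ ∧ ⌊ v ≟ x ⌋)

switchAdj : ∀ {n} → Graph n → Fin n → Fin n → Fin n → Fin n →
            Fin n → Fin n → Bool
switchAdj G a b c d u v =
  if samePair u v a b ∨ samePair u v c d then false
  else if samePair u v b c ∨ samePair u v a d then true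
  else adj G u v

_≅_ : ∀ {n} → Graph n → Graph n → Set
_≅_ {n} G H = Σ (Fin n ↔ Fin n) λ σ →
  ∀ u v → adj G u v ≡ adj H (Inverse.to σ u) (Inverse.to σ v)

-- {x,y} is a module of G - {p,q}: every vertex w of G - {p,q}
-- outside {x,y} is adjacent to both x and y or to neither.
-- (assumes x,y ∉ {p,q}, as in the intended use)
ModuleMinus : ∀ {n} → Graph n → (x y p q : Fin n) → Set
ModuleMinus G x y p q =
  ∀ w → w ≢ p → w ≢ q → w ≢ x → w ≢ y → adj G w x ≡ adj G w y

-- Every switched pair has one end in {a,c} and the other in {b,d}, and the
-- 2-switch flips it; since ab, cd are edges and bc, ad non-edges, swapping a
-- and c flips the same four pairs. If {a,c} is a module of G − {b,d}, the
-- transposition (a c) preserves every other adjacency, so H is G relabelled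
-- by (a c). The case of {b,d} reduces to this one: ⟨b,a:d,c⟩ is an
-- alternating 4-cycle with the same 2-switch.
module Submission where

open import Defs hiding (sym)
open import Data.Nat using (ℕ)
open import Data.Fin using (Fin; _≟_)
open import Data.Sum using (_⊎_; inj₁; inj₂)
open import Data.Bool using (true; false; _∧_; _∨_)
open import Data.Bool.Properties using (∧-zeroʳ; ∨-comm; ∨-zeroʳ)
open import Data.Product using (_,_)
open import Relation.Nullary using (Dec; yes; no; ¬_)
open import Relation.Nullary.Decidable using (isYes; dec-true; dec-false; isYes≗does)
open import Relation.Binary.PropositionalEquality
  using (_≡_; _≢_; refl; sym; trans; cong₂; ≢-sym; module ≡-Reasoning)
open import Function.Bundles using (_↔_; Inverse)
import Data.Fin.Permutation as Perm
import Data.Fin.Permutation.Components as PC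

private
  variable
    n : ℕ
    G H : Graph n
    a b c d u v x y : Fin n

data Transposition (i j : Fin n) : Fin n → Fin n → Set where
  at-i      : Transposition i j i j
  at-j      : Transposition i j j i
  elsewhere : ∀ {k} → k ≢ i → k ≢ j → Transposition i j k k

transposition : (i j k : Fin n) → Transposition i j k (PC.transpose i j k)
transposition i j k with k ≟ i
... | yes refl = at-i
... | no k≢i with k ≟ j
...   | yes refl = at-j
...   | no k≢j = elsewhere k≢i k≢j

≅-fromRelabelling : (σ : Fin n ↔ Fin n) →
  (∀ u v → adj G (Inverse.from σ u) (Inverse.from σ v) ≡ adj H u v) → G ≅ H
≅-fromRelabelling {G = G} σ relabel = σ , λ u v →
  trans (sym (cong₂ (adj G) (Inverse.strictlyInverseʳ σ u) (Inverse.strictlyInverseʳ σ v)))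
        (relabel (Inverse.to σ u) (Inverse.to σ v))

isYes-true : {A : Set} (a? : Dec A) → A → isYes a? ≡ true
isYes-true a? a = trans (isYes≗does a?) (dec-true a? a)

isYes-false : {A : Set} (a? : Dec A) → ¬ A → isYes a? ≡ false
isYes-false a? ¬a = trans (isYes≗does a?) (dec-false a? ¬a)

samePair-refl : (x y : Fin n) → samePair x y x y ≡ true
samePair-refl x y rewrite isYes-true (x ≟ x) refl | isYes-true (y ≟ y) refl = refl

samePair-sym : (u v x y : Fin n) → samePair u v x y ≡ samePair u v y x
samePair-sym u v x y =
  ∨-comm (isYes (u ≟ x) ∧ isYes (v ≟ y)) (isYes (u ≟ y) ∧ isYes (v ≟ x))

samePair-≢ˡ : u ≢ x → u ≢ y → samePair u v x y ≡ false
samePair-≢ˡ {u = u} {x} {y} u≢x u≢y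
  rewrite isYes-false (u ≟ x) u≢x | isYes-false (u ≟ y) u≢y = refl

samePair-≢ʳ : v ≢ x → v ≢ y → samePair u v x y ≡ false
samePair-≢ʳ {v = v} {x} {y} {u} v≢x v≢y
  rewrite isYes-false (v ≟ x) v≢x | isYes-false (v ≟ y) v≢y
        | ∧-zeroʳ (isYes (u ≟ x)) | ∧-zeroʳ (isYes (u ≟ y)) = refl

samePair-missˡ : u ≢ x → v ≢ x → samePair u v x y ≡ false
samePair-missˡ {u = u} {x} {v} {y} u≢x v≢x
  rewrite isYes-false (u ≟ x) u≢x | isYes-false (v ≟ x) v≢x
        | ∧-zeroʳ (isYes (u ≟ y)) = refl

samePair-missʳ : u ≢ y → v ≢ y → samePair u v x y ≡ false
samePair-missʳ {u = u} {y} {v} {x} u≢y v≢y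
  rewrite isYes-false (u ≟ y) u≢y | isYes-false (v ≟ y) v≢y
        | ∧-zeroʳ (isYes (u ≟ x)) = refl

module TwoSwitch {n} (G : Graph n) (a b c d : Fin n) where

  switchAdj-untouched :
    samePair u v a b ≡ false → samePair u v c d ≡ false →
    samePair u v b c ≡ false → samePair u v a d ≡ false →
    switchAdj G a b c d u v ≡ adj G u v
  switchAdj-untouched ab cd bc ad rewrite ab | cd | bc | ad = refl

  switchAdj-off-ac : u ≢ a → u ≢ c → v ≢ a → v ≢ c → switchAdj G a b c d u v ≡ adj G u v
  switchAdj-off-ac u≢a u≢c v≢a v≢c = switchAdj-untouched
    (samePair-missˡ u≢a v≢a) (samePair-missˡ u≢c v≢c)
    (samePair-missʳ u≢c v≢c) (samePair-missˡ u≢a v≢a)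

  switchAdj-off-bd : u ≢ b → u ≢ d → v ≢ b → v ≢ d → switchAdj G a b c d u v ≡ adj G u v
  switchAdj-off-bd u≢b u≢d v≢b v≢d = switchAdj-untouched
    (samePair-missʳ u≢b v≢b) (samePair-missʳ u≢d v≢d)
    (samePair-missˡ u≢b v≢b) (samePair-missʳ u≢d v≢d)

  switchAdj-ab : switchAdj G a b c d a b ≡ false
  switchAdj-ab rewrite samePair-refl a b = refl

  switchAdj-cd : switchAdj G a b c d c d ≡ false
  switchAdj-cd rewrite samePair-refl c d | ∨-zeroʳ (samePair c d a b) = refl

  switchAdj-bc : Distinct4 a b c d → switchAdj G a b c d b c ≡ true
  switchAdj-bc (_ , a≢c , _ , b≢c , b≢d , _)
    rewrite samePair-≢ʳ {u = b} (≢-sym a≢c) (≢-sym b≢c) | samePair-≢ˡ {v = c} b≢c b≢d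
          | samePair-refl b c = refl

  switchAdj-ad : Distinct4 a b c d → switchAdj G a b c d a d ≡ true
  switchAdj-ad (a≢b , a≢c , a≢d , _ , b≢d , _)
    rewrite samePair-≢ʳ {u = a} (≢-sym a≢d) (≢-sym b≢d) | samePair-≢ˡ {v = d} a≢c a≢d
          | samePair-≢ˡ {v = d} a≢b a≢c | samePair-refl a d = refl

switchAdj-mirror : (G : Graph n) (a b c d u v : Fin n) →
  switchAdj G b a d c u v ≡ switchAdj G a b c d u v
switchAdj-mirror G a b c d u v
  rewrite samePair-sym u v b a | samePair-sym u v d c
        | ∨-comm (samePair u v a d) (samePair u v b c) = refl

altCycle-mirror : (G : Graph n) (a b c d : Fin n) → AltCycle G a b c d → AltCycle G b a d c
altCycle-mirror G a b c d ((a≢b , a≢c , a≢d , b≢c , b≢d , c≢d) , ab , cd , bc , ad) =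
  (≢-sym a≢b , b≢d , b≢c , a≢d , a≢c , ≢-sym c≢d) ,
  trans (Graph.sym G b a) ab , trans (Graph.sym G d c) cd , ad , bc

-- PC.transpose c a is the inverse of Perm.transpose a c.
switch-relabels-by-transposition : (G : Graph n) (a b c d : Fin n) → AltCycle G a b c d →
  (H : Graph n) → (∀ u v → adj H u v ≡ switchAdj G a b c d u v) → ModuleMinus G a c b d →
  ∀ u v → adj G (PC.transpose c a u) (PC.transpose c a v) ≡ adj H u v
switch-relabels-by-transposition G a b c d
  (distinct@(a≢b , _ , a≢d , b≢c , _ , c≢d) , ab , cd , bc , ad) H H-switch M = relabel
  where
  open TwoSwitch G a b c d
  open ≡-Reasoning

  H-from-switch : ∀ {x y β} → switchAdj G a b c d x y ≡ β → adj H x y ≡ β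
  H-from-switch {x} {y} = trans (H-switch x y)

  loopless : ∀ x y → adj G x x ≡ adj H y y
  loopless x y = trans (irrefl G x) (sym (irrefl H y))

  ca-unswitched : adj H c a ≡ adj G c a
  ca-unswitched = H-from-switch (switchAdj-off-bd (≢-sym b≢c) c≢d a≢b a≢d)

  nbhd-a↦c : ∀ {w} → w ≢ c → w ≢ a → adj G a w ≡ adj H c w
  nbhd-a↦c {w} w≢c w≢a with w ≟ b | w ≟ d
  ... | yes refl | _ =
    trans ab (sym (trans (Graph.sym H c b) (H-from-switch (switchAdj-bc distinct))))
  ... | no _ | yes refl = trans ad (sym (H-from-switch switchAdj-cd))
  ... | no w≢b | no w≢d = begin
    adj G a w  ≡⟨ Graph.sym G a w ⟩
    adj G w a  ≡⟨ M w w≢b w≢d w≢a w≢c ⟩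
    adj G w c  ≡⟨ Graph.sym G w c ⟩
    adj G c w  ≡⟨ H-from-switch (switchAdj-off-bd (≢-sym b≢c) c≢d w≢b w≢d) ⟨
    adj H c w  ∎

  nbhd-c↦a : ∀ {w} → w ≢ c → w ≢ a → adj G c w ≡ adj H a w
  nbhd-c↦a {w} w≢c w≢a with w ≟ b | w ≟ d
  ... | yes refl | _ = trans (Graph.sym G c b) (trans bc (sym (H-from-switch switchAdj-ab)))
  ... | no _ | yes refl = trans cd (sym (H-from-switch (switchAdj-ad distinct)))
  ... | no w≢b | no w≢d = begin
    adj G c w  ≡⟨ Graph.sym G c w ⟩
    adj G w c  ≡⟨ M w w≢b w≢d w≢a w≢c ⟨
    adj G w a  ≡⟨ Graph.sym G w a ⟩
    adj G a w  ≡⟨ H-from-switch (switchAdj-off-bd a≢b a≢d w≢b w≢d) ⟨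
    adj H a w  ∎

  relabel : ∀ u v → adj G (PC.transpose c a u) (PC.transpose c a v) ≡ adj H u v
  relabel u v
    with PC.transpose c a u | transposition c a u | PC.transpose c a v | transposition c a v
  ... | _ | at-i | _ | at-i = loopless a c
  ... | _ | at-i | _ | at-j = trans (Graph.sym G a c) (sym ca-unswitched)
  ... | _ | at-i | _ | elsewhere v≢c v≢a = nbhd-a↦c v≢c v≢a
  ... | _ | at-j | _ | at-i = trans (sym ca-unswitched) (Graph.sym H c a)
  ... | _ | at-j | _ | at-j = loopless c a
  ... | _ | at-j | _ | elsewhere v≢c v≢a = nbhd-c↦a v≢c v≢a
  ... | _ | elsewhere u≢c u≢a | _ | at-i =
    trans (Graph.sym G u a) (trans (nbhd-a↦c u≢c u≢a) (Graph.sym H c u))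
  ... | _ | elsewhere u≢c u≢a | _ | at-j =
    trans (Graph.sym G u c) (trans (nbhd-c↦a u≢c u≢a) (Graph.sym H a u))
  ... | _ | elsewhere u≢c u≢a | _ | elsewhere v≢c v≢a =
    sym (H-from-switch (switchAdj-off-ac u≢a u≢c v≢a v≢c))

lemma2p1 : ∀ {n} (G : Graph n) (a b c d : Fin n) →
    (alt : AltCycle G a b c d) →
    (H : Graph n) → (∀ u v → adj H u v ≡ switchAdj G a b c d u v) →
    (ModuleMinus G a c b d ⊎ ModuleMinus G b d a c) →
    G ≅ H
lemma2p1 G a b c d alt H H-switch (inj₁ M) =
  ≅-fromRelabelling {G = G} {H = H} (Perm.transpose a c)
    (switch-relabels-by-transposition G a b c d alt H H-switch M)
lemma2p1 G a b c d alt H H-switch (inj₂ M) =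
  ≅-fromRelabelling {G = G} {H = H} (Perm.transpose b d)
    (switch-relabels-by-transposition G b a d c (altCycle-mirror G a b c d alt) H
      (λ u v → trans (H-switch u v) (sym (switchAdj-mirror G a b c d u v))) M)
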